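{- Let $\tau,\sigma$ be non-crossing partitions of $\{\bar1,\dots,\bar n\}$ and $i\in[2n]$ be such that either $i$ is a non-singleton element in both $(\tau|\tilde\tau)$ and $(\sigma|\tilde\sigma)$, or $i$ is a singleton block in both. Then $\langle g_i\tau,\sigma\rangle=\langle\tau,g_i\sigma\rangle$.
   Context: Place $\bar 1,\dots,\bar n$ clockwise on a circle and $\tilde i$ on the arc between $\bar i$ and $\overline{i+1}$ ($\tilde n$ between $\bar n$ and $\bar1$). For a non-crossing partition $\sigma$ of $\{\bar 1,\dots,\bar n\}$, $\tilde\sigma$ is the coarsest partition of $\{\tilde1,\dots,\tilde n\}$ with $\sigma\cup\tilde\sigma$ non-crossing; $\sigma\mapsto\tilde\sigma$ is a bijection. Identifying $\bar k\leftrightarrow 2k-1$, $\tilde k\leftrightarrow 2k$ gives a partition $(\sigma|\tilde\sigma)$ of $[2n]$. Isolation $g_i$: if $i$ is a singleton of $(\sigma|\tilde\sigma)$, $g_i\sigma=\sigma$; if $i=2k-1$ and $\bar k$ is not a singleton, $g_i\sigma$ is $\sigma$ with $\bar k$ moved into its own singleton block; if $i=2k$ and $\tilde k$ is not a singleton in $\tilde\sigma$, $g_i\sigma$ is the unique non-crossing partition whose dual is $\tilde\sigma$ with $\tilde k$ moved into its own singleton block. For non-crossing partitions $\tau,\sigma$ of $\{\bar 1,\dots,\bar n\}$, $\langle\tau,\sigma\rangle\in\{0,1\}$ equals $1$ iff (1) the numbers of blocks of $\tau$ and $\sigma$ sum to $n+1$, and (2) the finest partition of $\{\bar1,\dots,\bar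 n\}$ coarser than both $\tau$ and $\sigma$ has a single block. -}

module Defs where

open import Data.Nat using (ℕ; suc; _+_; _*_; _<_; _≤_; _<?_)
open import Data.Fin using (Fin; toℕ; _≟_)
open import Data.Fin.Properties using ()
open import Data.Bool using (Bool; true; false; _∧_; _∨_; not)
open import Data.List using (List; length; filterᵇ)
open import Data.Bool.ListAction using (any)
open import Data.List.Base using ()
open import Data.Fin.Base using ()
open import Data.Product using (_×_; Σ; ∃)
open import Data.Sum using (_⊎_)
open import Relation.Nullary using (¬_; yes; no)
open import Relation.Nullary.Decidable using (⌊_⌋)
open import Relation.Binary.PropositionalEquality using (_≡_)
open import Relation.Binary.Construct.Closure.ReflexiveTransitive using (Star)
import Data.List as L
import Data.Fin as F

-- A (set) partition of a finite type is encoded by its "same block" relation.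
BRel : Set → Set
BRel A = A → A → Bool

-- Partition of {1̄,…,n̄} (encoded 0-indexed by Fin n).
Rel : ℕ → Set
Rel n = BRel (Fin n)

IsPartition : {A : Set} → BRel A → Set
IsPartition {A} R =
  (∀ a → R a a ≡ true) ×
  (∀ a b → R a b ≡ true → R b a ≡ true) ×
  (∀ a b c → R a b ≡ true → R b c ≡ true → R a c ≡ true)

-- Non-crossing w.r.t. the cyclic (equivalently linear) order given by pos.
NonCrossingOn : {A : Set} → (A → ℕ) → BRel A → Set
NonCrossingOn {A} pos R =
  ∀ a b c d → pos a < pos b → pos b < pos c → pos c < pos d →
  R a c ≡ true → R b d ≡ true → R a b ≡ true

NCPartition : ∀ {n} → Rel n → Set
NCPartition R = IsPartition R × NonCrossingOn toℕ R

-- The 2n points: bar k and tilde k (k : Fin n, 0-indexed).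
-- bar k ↔ 2k-1 and tilde k ↔ 2k in the paper's 1-indexed [2n].
data Pt (n : ℕ) : Set where
  bar : Fin n → Pt n
  tld : Fin n → Pt n

pos : ∀ {n} → Pt n → ℕ
pos (bar k) = 2 * toℕ k
pos (tld k) = suc (2 * toℕ k)

union : ∀ {n} → Rel n → Rel n → BRel (Pt n)
union σ σ' (bar a) (bar b) = σ a b
union σ σ' (tld a) (tld b) = σ' a b
union σ σ' (bar a) (tld b) = false
union σ σ' (tld a) (bar b) = false

IsDual : ∀ {n} → Rel n → Rel n → Set
IsDual {n} σ σ' =
  IsPartition σ' × NonCrossingOn pos (union σ σ') ×
  (∀ ρ → IsPartition ρ → NonCrossingOn pos (union σ ρ) →
     ∀ a b → ρ a b ≡ true → σ' a b ≡ true)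

IsSingleton : {A : Set} → BRel A → A → Set
IsSingleton R p = ∀ q → R p q ≡ true → q ≡ p

isolate : ∀ {n} → Rel n → Fin n → Rel n
isolate R k a b with a ≟ k | b ≟ k
... | yes _ | yes _ = true
... | no _  | no _  = R a b
... | _     | _     = false

_≐_ : ∀ {n} → Rel n → Rel n → Set
R ≐ S = ∀ a b → R a b ≡ S a b

IsIsolation : ∀ {n} → Pt n → Rel n → Rel n → Set
IsIsolation (bar k) τ ρ = NCPartition ρ × (ρ ≐ isolate τ k)
IsIsolation (tld k) τ ρ =
  NCPartition ρ ×
  Σ _ (λ τ' → Σ _ (λ ρ' → IsDual τ τ' × IsDual ρ ρ' × (ρ' ≐ isolate τ' k)))

isBlockMin : ∀ {n} → Rel n → Fin n → Bool
isBlockMin {n} R a = not (any (λ b → ⌊ toℕ b <? toℕ a ⌋ ∧ R a b) (L.allFin n))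

nBlocks : ∀ {n} → Rel n → ℕ
nBlocks {n} R = length (filterᵇ (isBlockMin R) (L.allFin n))

step : ∀ {n} → Rel n → Rel n → Fin n → Fin n → Set
step τ σ a b = (τ a b ≡ true) ⊎ (σ a b ≡ true)

JoinSingleBlock : ∀ {n} → Rel n → Rel n → Set
JoinSingleBlock τ σ = ∀ a b → Star (step τ σ) a b

-- ⟨τ,σ⟩ = 1
Pairing : ∀ {n} → Rel n → Rel n → Set
Pairing {n} τ σ = (nBlocks τ + nBlocks σ ≡ suc n) × JoinSingleBlock τ σ

-- The dual is described by chords: ã and b̃ share a block of σ̃ exactly when the chord ã–b̃
-- crosses no block of σ, and a non-crossing partition is determined by the chords it leaves
-- uncrossed. So isolating a non-singleton bar point k̄ splits one block of σ, while isolating a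
-- non-singleton tilde point k̃ merges the blocks of k̄ and of the bar point following k̃; for a
-- singleton, g_i is the identity. In either case g_i changes the number of blocks of τ and of σ
-- by the same ±1, so the counts in ⟨g_i τ, σ⟩ and ⟨τ, g_i σ⟩ agree, and a path connecting all
-- points through blocks of g_i τ and σ can be rerouted through blocks of τ and g_i σ, and back.

module Submission where

open import Defs
open import Data.Nat using (ℕ)
open import Data.Product using (_×_)
open import Data.Sum using (_⊎_)
open import Relation.Nullary using (¬_)
open import Function.Bundles using (_⇔_)

open import Data.Bool as Bool using (Bool; true; false; _∧_; _∨_; not)
open import Data.Bool.Properties using (∨-comm; ∧-conicalˡ; ∧-conicalʳ; not-¬; ¬-not)
open import Data.Bool.ListAction using (any; or)
open import Data.Empty using (⊥; ⊥-elim)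
open import Data.Fin as F using (Fin; toℕ; _≟_)
import Data.Fin.Properties as FinP
open import Data.List using (List; []; _∷_; length; filterᵇ; tabulate; allFin)
open import Data.List.Membership.Propositional using (_∈_)
open import Data.List.Membership.Propositional.Properties using (∈-allFin)
open import Data.List.Properties using (map-cong)
open import Data.List.Relation.Unary.Any using (here; there)
open import Data.Nat using (zero; suc; _+_; _*_; _<_; _≤_; z≤n; s≤s; _<?_; _≤?_) renaming (_≟_ to _≟ℕ_)
open import Data.Nat.Properties hiding (_≟_)
open import Data.Product using (Σ; ∃; _,_; proj₁; proj₂)
open import Data.Sum using (inj₁; inj₂)
open import Function.Base using (_∘_; id)
open import Function.Bundles using (mk⇔; Equivalence)
open import Relation.Binary.Construct.Closure.ReflexiveTransitive using (Star; ε; _◅_; _◅◅_)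
import Relation.Binary.Construct.Closure.ReflexiveTransitive as Star
open import Relation.Binary.Definitions using (Tri; tri<; tri≈; tri>)
open import Relation.Binary.PropositionalEquality
open import Relation.Nullary using (yes; no; Dec; ¬?)
open import Relation.Nullary.Decidable using (⌊_⌋; _×-dec_)

private
  variable
    n : ℕ
    A : Set

∨-true⁻ : ∀ {a b} → a ∨ b ≡ true → a ≡ true ⊎ b ≡ true
∨-true⁻ {true}  _ = inj₁ refl
∨-true⁻ {false} e = inj₂ e

∨-trueˡ : ∀ {a} b → a ≡ true → a ∨ b ≡ true
∨-trueˡ b refl = refl

∨-trueʳ : ∀ a {b} → b ≡ true → a ∨ b ≡ true
∨-trueʳ true  _ = refl
∨-trueʳ false e = e

∧-true : ∀ {a b} → a ≡ true → b ≡ true → a ∧ b ≡ true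
∧-true refl refl = refl

∧-true⁻ : ∀ {a b} → a ∧ b ≡ true → a ≡ true × b ≡ true
∧-true⁻ {a} {b} e = ∧-conicalˡ a b e , ∧-conicalʳ a b e

bool-ext : ∀ {x y : Bool} → (x ≡ true → y ≡ true) → (y ≡ true → x ≡ true) → x ≡ y
bool-ext {true}  f g = sym (f refl)
bool-ext {false} {true}  f g = g refl
bool-ext {false} {false} f g = refl

is-true? : (b : Bool) → Dec (b ≡ true)
is-true? b = b Bool.≟ true

<?-true : ∀ {x y} → x < y → ⌊ x <? y ⌋ ≡ true
<?-true {x} {y} x<y with x <? y
... | yes _   = refl
... | no  x≮y = ⊥-elim (x≮y x<y)

≟-true : {a b : Fin n} → a ≡ b → ⌊ a ≟ b ⌋ ≡ true
≟-true {a = a} {b} a≡b with a ≟ b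
... | yes _   = refl
... | no  a≢b = ⊥-elim (a≢b a≡b)

≟-true⁻ : {a b : Fin n} → ⌊ a ≟ b ⌋ ≡ true → a ≡ b
≟-true⁻ {a = a} {b} e with a ≟ b
... | yes a≡b = a≡b

_⊆ᴮ_ : BRel A → BRel A → Set
R ⊆ᴮ S = ∀ a b → R a b ≡ true → S a b ≡ true

module _ {R : BRel A} (P : IsPartition R) where
  block-refl : ∀ a → R a a ≡ true
  block-refl = proj₁ P

  block-sym : ∀ {a b} → R a b ≡ true → R b a ≡ true
  block-sym {a} {b} = proj₁ (proj₂ P) a b

  block-trans : ∀ {a b c} → R a b ≡ true → R b c ≡ true → R a c ≡ true
  block-trans {a} {b} {c} = proj₂ (proj₂ P) a b c

  block-sym-false : ∀ {a b} → R a b ≡ false → R b a ≡ false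
  block-sym-false ab = ¬-not λ ba → not-¬ (block-sym ba) ab

≐-refl : {R : Rel n} → R ≐ R
≐-refl a b = refl

≐-sym : {R S : Rel n} → R ≐ S → S ≐ R
≐-sym e a b = sym (e a b)

≐-trans : {R S T : Rel n} → R ≐ S → S ≐ T → R ≐ T
≐-trans e f a b = trans (e a b) (f a b)

toℕ-<⇒≢ : {a b : Fin n} → toℕ a < toℕ b → a ≢ b
toℕ-<⇒≢ a<b refl = <-irrefl refl a<b

Least : (Fin n → Set) → Set
Least {n} P = Σ (Fin n) λ m → P m × (∀ b → P b → toℕ m ≤ toℕ b)

Greatest : (Fin n → Set) → Set
Greatest {n} P = Σ (Fin n) λ m → P m × (∀ b → P b → toℕ b ≤ toℕ m)

module _ {P : Fin n → Set} (P? : ∀ a → Dec (P a)) where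
  private
    least-below : ∀ N a → P a → toℕ a < N → Least P
    least-below (suc N) a pa a<N with FinP.any? (λ b → P? b ×-dec (toℕ b <? N))
    ... | yes (b , pb , b<N) = least-below N b pb b<N
    ... | no ∄b = a , pa , λ b pb → ≮⇒≥ λ b<a → ∄b (b , pb , <-≤-trans b<a (≤-pred a<N))

    greatest-below : ∀ N a → P a → (∀ b → P b → toℕ b < N) → Greatest P
    greatest-below zero    a pa bound = ⊥-elim (n≮0 (bound a pa))
    greatest-below (suc N) a pa bound with FinP.any? (λ b → P? b ×-dec (toℕ b ≟ℕ N))
    ... | yes (b , pb , b≡N) = b , pb , λ c pc → subst (toℕ c ≤_) (sym b≡N) (≤-pred (bound c pc))
    ... | no ∄b = greatest-below N a pa λ c pc →
      ≤∧≢⇒< (≤-pred (bound c pc)) λ c≡N → ∄b (c , pc , c≡N)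

  least : ∀ a → P a → Least P
  least a pa = least-below n a pa (FinP.toℕ<n a)

  greatest : ∀ a → P a → Greatest P
  greatest a pa = greatest-below n a pa λ b _ → FinP.toℕ<n b

-- Counting block minima

count-cong : (f g : A → Bool) (h : Fin n → A) → (∀ a → f (h a) ≡ g (h a)) →
  length (filterᵇ f (tabulate h)) ≡ length (filterᵇ g (tabulate h))
count-cong {n = zero}  f g h agree = refl
count-cong {n = suc n} f g h agree with f (h F.zero) | g (h F.zero) | agree F.zero
... | true  | .true  | refl = cong suc (count-cong f g (h ∘ F.suc) (agree ∘ F.suc))
... | false | .false | refl = count-cong f g (h ∘ F.suc) (agree ∘ F.suc)

count-flip : (f g : A → Bool) (h : Fin n → A) (p : Fin n) →
  f (h p) ≡ true → g (h p) ≡ false → (∀ a → a ≢ p → f (h a) ≡ g (h a)) →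
  length (filterᵇ f (tabulate h)) ≡ suc (length (filterᵇ g (tabulate h)))
count-flip f g h F.zero fp gp agree rewrite fp | gp =
  cong suc (count-cong f g (h ∘ F.suc) λ a → agree (F.suc a) λ ())
count-flip f g h (F.suc p) fp gp agree with f (h F.zero) | g (h F.zero) | agree F.zero (λ ())
... | true  | .true  | refl =
  cong suc (count-flip f g (h ∘ F.suc) p fp gp λ a a≢p → agree (F.suc a) (a≢p ∘ FinP.suc-injective))
... | false | .false | refl =
  count-flip f g (h ∘ F.suc) p fp gp λ a a≢p → agree (F.suc a) (a≢p ∘ FinP.suc-injective)

nBlocks-cong : {R S : Rel n} → R ≐ S → nBlocks R ≡ nBlocks S
nBlocks-cong {n} e = count-cong _ _ id λ a →
  cong (not ∘ or) (map-cong (λ b → cong (⌊ toℕ b <? toℕ a ⌋ ∧_) (e a b)) (allFin n))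

nBlocks-flip : (R S : Rel n) (p : Fin n) →
  isBlockMin R p ≡ true → isBlockMin S p ≡ false → (∀ a → a ≢ p → isBlockMin R a ≡ isBlockMin S a) →
  nBlocks R ≡ suc (nBlocks S)
nBlocks-flip R S = count-flip (isBlockMin R) (isBlockMin S) id

private
  any-false : (p : A → Bool) (xs : List A) → (∀ x → p x ≡ false) → any p xs ≡ false
  any-false p []       none = refl
  any-false p (x ∷ xs) none rewrite none x = any-false p xs none

  any-true : (p : A → Bool) {x : A} (xs : List A) → x ∈ xs → p x ≡ true → any p xs ≡ true
  any-true p (y ∷ xs) (here refl) px rewrite px = refl
  any-true p (y ∷ xs) (there x∈) px = ∨-trueʳ (p y) (any-true p xs x∈ px)

isBlockMin-intro : (R : Rel n) (a : Fin n) → (∀ b → toℕ b < toℕ a → R a b ≡ false) →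
  isBlockMin R a ≡ true
isBlockMin-intro {n} R a below = cong not (any-false _ (allFin n) none)
  where
  none : ∀ b → (⌊ toℕ b <? toℕ a ⌋ ∧ R a b) ≡ false
  none b with toℕ b <? toℕ a
  ... | yes b<a = below b b<a
  ... | no  _   = refl

isBlockMin-reject : (R : Rel n) {a : Fin n} (b : Fin n) → toℕ b < toℕ a → R a b ≡ true →
  isBlockMin R a ≡ false
isBlockMin-reject {n} R {a} b b<a ab =
  cong not (any-true _ (allFin n) (∈-allFin b) (∧-true (<?-true b<a) ab))

isBlockMin-elim : (R : Rel n) {a : Fin n} → isBlockMin R a ≡ true → (b : Fin n) → toℕ b < toℕ a →
  R a b ≡ false
isBlockMin-elim R min b b<a = ¬-not λ ab → not-¬ min (isBlockMin-reject R b b<a ab)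

-- Isolating a point

module _ (R : Rel n) (k : Fin n) where
  isolate-off : ∀ {a b} → a ≢ k → b ≢ k → isolate R k a b ≡ R a b
  isolate-off {a} {b} a≢k b≢k with a ≟ k | b ≟ k
  ... | yes a≡k | _       = ⊥-elim (a≢k a≡k)
  ... | no _    | yes b≡k = ⊥-elim (b≢k b≡k)
  ... | no _    | no _    = refl

  isolate-self : isolate R k k k ≡ true
  isolate-self with k ≟ k
  ... | yes _   = refl
  ... | no  k≢k = ⊥-elim (k≢k refl)

  isolate-apartˡ : ∀ {b} → b ≢ k → isolate R k k b ≡ false
  isolate-apartˡ {b} b≢k with k ≟ k | b ≟ k
  ... | no k≢k | _       = ⊥-elim (k≢k refl)
  ... | yes _  | yes b≡k = ⊥-elim (b≢k b≡k)
  ... | yes _  | no _    = refl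

  isolate-apartʳ : ∀ {a} → a ≢ k → isolate R k a k ≡ false
  isolate-apartʳ {a} a≢k with a ≟ k | k ≟ k
  ... | yes a≡k | _      = ⊥-elim (a≢k a≡k)
  ... | no _    | no k≢k = ⊥-elim (k≢k refl)
  ... | no _    | yes _  = refl

  isolate-true⁻ : ∀ {a b} → isolate R k a b ≡ true →
    (a ≡ k × b ≡ k) ⊎ (a ≢ k × b ≢ k × R a b ≡ true)
  isolate-true⁻ {a} {b} e with a ≟ k | b ≟ k
  ... | yes a≡k | yes b≡k = inj₁ (a≡k , b≡k)
  ... | no a≢k  | no b≢k  = inj₂ (a≢k , b≢k , e)

  isolate-⊆ : IsPartition R → isolate R k ⊆ᴮ R
  isolate-⊆ P a b e with isolate-true⁻ {a} {b} e
  ... | inj₁ (refl , refl)  = block-refl P a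
  ... | inj₂ (_ , _ , ab) = ab

  isolate-singleton : IsPartition R → (∀ j → R k j ≡ true → j ≡ k) → isolate R k ≐ R
  isolate-singleton P only-k a b with a ≟ k | b ≟ k
  ... | yes refl | yes refl = sym (block-refl P a)
  ... | no _     | no _     = refl
  ... | yes refl | no b≢k   = sym (¬-not λ ab → b≢k (only-k b ab))
  ... | no a≢k   | yes refl = sym (¬-not λ ab → a≢k (only-k a (block-sym P ab)))

  isBlockMin-isolate-self : isBlockMin (isolate R k) k ≡ true
  isBlockMin-isolate-self = isBlockMin-intro (isolate R k) k λ b b<k → isolate-apartˡ {b} (toℕ-<⇒≢ b<k)

  isBlockMin-isolate⁺ : ∀ {a} → a ≢ k → isBlockMin R a ≡ true → isBlockMin (isolate R k) a ≡ true
  isBlockMin-isolate⁺ {a} a≢k min = isBlockMin-intro (isolate R k) a λ b b<a → ¬-not λ iab →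
    not-¬ (isolate-⊆-off iab) (isBlockMin-elim R min b b<a)
    where
    isolate-⊆-off : ∀ {b} → isolate R k a b ≡ true → R a b ≡ true
    isolate-⊆-off iab with isolate-true⁻ iab
    ... | inj₁ (a≡k , _)   = ⊥-elim (a≢k a≡k)
    ... | inj₂ (_ , _ , ab) = ab

  isolate-lower-mate : ∀ {a c} → a ≢ k → c ≢ k → isBlockMin (isolate R k) a ≡ true →
    toℕ c < toℕ a → R a c ≡ true → ⊥
  isolate-lower-mate {c = c} a≢k c≢k min c<a ac =
    not-¬ (trans (isolate-off a≢k c≢k) ac) (isBlockMin-elim (isolate R k) min c c<a)

  isBlockMin-isolate⁻ : ∀ {a} → a ≢ k → isBlockMin (isolate R k) a ≡ true →
    isBlockMin R a ≡ true ⊎ (toℕ k < toℕ a × R a k ≡ true)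
  isBlockMin-isolate⁻ {a} a≢k min with FinP.any? (λ c → (toℕ c <? toℕ a) ×-dec is-true? (R a c))
  ... | no ∄c = inj₁ (isBlockMin-intro R a λ c c<a → ¬-not λ ac → ∄c (c , c<a , ac))
  ... | yes (c , c<a , ac) with c ≟ k
  ...   | yes refl = inj₂ (c<a , ac)
  ...   | no c≢k   = ⊥-elim (isolate-lower-mate a≢k c≢k min c<a ac)

module _ {R : Rel n} (P : IsPartition R) (k : Fin n) where
  private
    nBlocks-isolate-non-minimal : ∀ {b} → toℕ b < toℕ k → R k b ≡ true →
      nBlocks (isolate R k) ≡ suc (nBlocks R)
    nBlocks-isolate-non-minimal {b} b<k kb =
      nBlocks-flip _ R k (isBlockMin-isolate-self R k) (isBlockMin-reject R b b<k kb) agree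
      where
      agree : ∀ a → a ≢ k → isBlockMin (isolate R k) a ≡ isBlockMin R a
      agree a a≢k = bool-ext to (isBlockMin-isolate⁺ R k a≢k)
        where
        to : isBlockMin (isolate R k) a ≡ true → isBlockMin R a ≡ true
        to min with isBlockMin-isolate⁻ R k a≢k min
        ... | inj₁ min′ = min′
        ... | inj₂ (k<a , ak) =
          ⊥-elim (isolate-lower-mate R k a≢k (toℕ-<⇒≢ b<k) min (<-trans b<k k<a) (block-trans P ak kb))

    -- The second-smallest point p of the block of k becomes a new block minimum.
    nBlocks-isolate-minimal : isBlockMin R k ≡ true → (p : Least λ b → b ≢ k × R k b ≡ true) →
      nBlocks (isolate R k) ≡ suc (nBlocks R)
    nBlocks-isolate-minimal k-min (p , (p≢k , kp) , p-least) =
      nBlocks-flip _ R p p-min (isBlockMin-reject R k k<p (block-sym P kp)) agree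
      where
      k<p : toℕ k < toℕ p
      k<p = ≤∧≢⇒< (≮⇒≥ λ p<k → not-¬ kp (isBlockMin-elim R k-min p p<k))
                  (p≢k ∘ sym ∘ FinP.toℕ-injective)

      p-min : isBlockMin (isolate R k) p ≡ true
      p-min = isBlockMin-intro (isolate R k) p λ b b<p → ¬-not λ ipb → lower b<p (isolate-true⁻ R k ipb)
        where
        lower : ∀ {b} → toℕ b < toℕ p → (p ≡ k × b ≡ k) ⊎ (p ≢ k × b ≢ k × R p b ≡ true) → ⊥
        lower b<p (inj₁ (p≡k , _))      = p≢k p≡k
        lower b<p (inj₂ (_ , b≢k , pb)) = <⇒≱ b<p (p-least _ (b≢k , block-trans P kp pb))

      agree : ∀ a → a ≢ p → isBlockMin (isolate R k) a ≡ isBlockMin R a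
      agree a a≢p = by-cases (a ≟ k)
        where
        by-cases : Dec (a ≡ k) → isBlockMin (isolate R k) a ≡ isBlockMin R a
        by-cases (yes refl) = trans (isBlockMin-isolate-self R k) (sym k-min)
        by-cases (no a≢k)   = bool-ext to (isBlockMin-isolate⁺ R k a≢k)
          where
          to : isBlockMin (isolate R k) a ≡ true → isBlockMin R a ≡ true
          to min with isBlockMin-isolate⁻ R k a≢k min
          ... | inj₁ min′ = min′
          ... | inj₂ (_ , ak) = ⊥-elim (isolate-lower-mate R k a≢k p≢k min p<a (block-trans P ak kp))
            where
            p<a : toℕ p < toℕ a
            p<a = ≤∧≢⇒< (p-least a (a≢k , block-sym P ak)) (a≢p ∘ sym ∘ FinP.toℕ-injective)

  nBlocks-isolate : ∀ {j} → j ≢ k → R k j ≡ true → nBlocks (isolate R k) ≡ suc (nBlocks R)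
  nBlocks-isolate {j} j≢k kj with FinP.any? (λ b → (toℕ b <? toℕ k) ×-dec is-true? (R k b))
  ... | yes (b , b<k , kb) = nBlocks-isolate-non-minimal b<k kb
  ... | no ∄b = nBlocks-isolate-minimal
    (isBlockMin-intro R k λ b b<k → ¬-not λ kb → ∄b (b , b<k , kb))
    (least (λ b → ¬? (b ≟ k) ×-dec is-true? (R k b)) j (j≢k , kj))

-- Merging two blocks

merge : Rel n → Fin n → Fin n → Rel n
merge R k m x y = R x y ∨ (R x k ∧ R m y ∨ R x m ∧ R k y)

module _ (R : Rel n) (k m : Fin n) where
  merge-comm : merge R k m ≐ merge R m k
  merge-comm x y = cong (R x y ∨_) (∨-comm (R x k ∧ R m y) (R x m ∧ R k y))

  merge-true⁻ : ∀ {x y} → merge R k m x y ≡ true →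
    R x y ≡ true ⊎ (R x k ≡ true × R m y ≡ true) ⊎ (R x m ≡ true × R k y ≡ true)
  merge-true⁻ {x} {y} e with ∨-true⁻ {R x y} e
  ... | inj₁ xy = inj₁ xy
  ... | inj₂ e′ with ∨-true⁻ {R x k ∧ R m y} e′
  ...   | inj₁ e″ = inj₂ (inj₁ (∧-true⁻ e″))
  ...   | inj₂ e″ = inj₂ (inj₂ (∧-true⁻ e″))

  merge-⊇ : R ⊆ᴮ merge R k m
  merge-⊇ x y = ∨-trueˡ _

  merge-joinˡ : ∀ {x y} → R x k ≡ true → R m y ≡ true → merge R k m x y ≡ true
  merge-joinˡ {x} {y} xk my = ∨-trueʳ (R x y) (∨-trueˡ _ (∧-true xk my))

  merge-joinʳ : ∀ {x y} → R x m ≡ true → R k y ≡ true → merge R k m x y ≡ true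
  merge-joinʳ {x} {y} xm ky = ∨-trueʳ (R x y) (∨-trueʳ (R x k ∧ R m y) (∧-true xm ky))

module _ {R : Rel n} (P : IsPartition R) where
  merge-sym : ∀ {k m x y} → merge R k m x y ≡ true → merge R k m y x ≡ true
  merge-sym {k} {m} {x} {y} e with merge-true⁻ R k m e
  ... | inj₁ xy               = merge-⊇ R k m y x (block-sym P xy)
  ... | inj₂ (inj₁ (xk , my)) = merge-joinʳ R k m (block-sym P my) (block-sym P xk)
  ... | inj₂ (inj₂ (xm , ky)) = merge-joinˡ R k m (block-sym P ky) (block-sym P xm)

  private
    -- With u < v the minima of the blocks of k and m, v stops being a block minimum.
    nBlocks-merge-ordered : ∀ {k m} (u : Least λ b → R k b ≡ true) (v : Least λ b → R m b ≡ true) →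
      toℕ (proj₁ u) < toℕ (proj₁ v) → nBlocks R ≡ suc (nBlocks (merge R k m))
    nBlocks-merge-ordered {k} {m} (u , ku , u-least) (v , mv , v-least) u<v =
      nBlocks-flip R (merge R k m) v v-min
        (isBlockMin-reject (merge R k m) u u<v (merge-joinʳ R k m (block-sym P mv) ku)) agree
      where
      v-min : isBlockMin R v ≡ true
      v-min = isBlockMin-intro R v λ b b<v → ¬-not λ vb → <⇒≱ b<v (v-least b (block-trans P mv vb))

      agree : ∀ a → a ≢ v → isBlockMin R a ≡ isBlockMin (merge R k m) a
      agree a a≢v = bool-ext to from
        where
        from : isBlockMin (merge R k m) a ≡ true → isBlockMin R a ≡ true
        from min = isBlockMin-intro R a λ b b<a → ¬-not λ ab →
          not-¬ (merge-⊇ R k m a b ab) (isBlockMin-elim (merge R k m) min b b<a)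

        to : isBlockMin R a ≡ true → isBlockMin (merge R k m) a ≡ true
        to min = isBlockMin-intro (merge R k m) a λ b b<a → ¬-not λ e → lower b<a (merge-true⁻ R k m e)
          where
          upper-bound : ∀ {c} → R a c ≡ true → toℕ a ≤ toℕ c
          upper-bound ac = ≮⇒≥ λ c<a → not-¬ ac (isBlockMin-elim R min _ c<a)

          lower : ∀ {b} → toℕ b < toℕ a →
            R a b ≡ true ⊎ (R a k ≡ true × R m b ≡ true) ⊎ (R a m ≡ true × R k b ≡ true) → ⊥
          lower {b} b<a (inj₁ ab) = not-¬ ab (isBlockMin-elim R min b b<a)
          lower b<a (inj₂ (inj₁ (ak , mb))) =
            <⇒≱ (<-trans (<-≤-trans b<a (upper-bound (block-trans P ak ku))) u<v) (v-least _ mb)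
          lower b<a (inj₂ (inj₂ (am , kb))) =
            a≢v (FinP.toℕ-injective
                  (≤-antisym (upper-bound (block-trans P am mv)) (v-least a (block-sym P am))))

  nBlocks-merge : ∀ {k m} → R k m ≡ false → nBlocks R ≡ suc (nBlocks (merge R k m))
  nBlocks-merge {k} {m} km
    with least (is-true? ∘ R k) k (block-refl P k) | least (is-true? ∘ R m) m (block-refl P m)
  ... | u | v with <-cmp (toℕ (proj₁ u)) (toℕ (proj₁ v))
  ...   | tri< u<v _ _ = nBlocks-merge-ordered u v u<v
  ...   | tri> _ _ v<u = trans (nBlocks-merge-ordered v u v<u) (cong suc (nBlocks-cong (merge-comm R m k)))
  ...   | tri≈ _ u≡v _ with FinP.toℕ-injective u≡v
  ...     | refl = ⊥-elim (not-¬ (block-trans P (proj₁ (proj₂ u)) (block-sym P (proj₁ (proj₂ v)))) km)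

-- Connectivity of the join and the pairing

joinSingleBlock-reroute : {A B A′ B′ : Rel n} → (∀ {x y} → step A B x y → Star (step A′ B′) x y) →
  JoinSingleBlock A B → JoinSingleBlock A′ B′
joinSingleBlock-reroute reroute J a b = (reroute Star.⋆) (J a b)

joinSingleBlock-comm : {A B : Rel n} → JoinSingleBlock A B → JoinSingleBlock B A
joinSingleBlock-comm = joinSingleBlock-reroute λ where
  (inj₁ e) → inj₂ e ◅ ε
  (inj₂ e) → inj₁ e ◅ ε

joinSingleBlock-cong : {A B A′ B′ : Rel n} → A ≐ A′ → B ≐ B′ →
  JoinSingleBlock A B → JoinSingleBlock A′ B′
joinSingleBlock-cong {A = A} {B} {A′} {B′} eA eB = joinSingleBlock-reroute reroute
  where
  reroute : ∀ {x y} → step A B x y → Star (step A′ B′) x y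
  reroute {x} {y} (inj₁ e) = inj₁ (trans (sym (eA x y)) e) ◅ ε
  reroute {x} {y} (inj₂ e) = inj₂ (trans (sym (eB x y)) e) ◅ ε

joinSingleBlock-merge-swap : {A B : Rel n} → IsPartition B → ∀ k m →
  JoinSingleBlock (merge A k m) B → JoinSingleBlock A (merge B k m)
joinSingleBlock-merge-swap {A = A} {B} PB k m = joinSingleBlock-reroute reroute
  where
  k~m : merge B k m k m ≡ true
  k~m = merge-joinˡ B k m (block-refl PB k) (block-refl PB m)

  m~k : merge B k m m k ≡ true
  m~k = merge-joinʳ B k m (block-refl PB m) (block-refl PB k)

  reroute : ∀ {x y} → step (merge A k m) B x y → Star (step A (merge B k m)) x y
  reroute {x} {y} (inj₂ e) = inj₂ (merge-⊇ B k m x y e) ◅ ε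
  reroute (inj₁ e) with merge-true⁻ A k m e
  ... | inj₁ xy               = inj₁ xy ◅ ε
  ... | inj₂ (inj₁ (xk , my)) = inj₁ xk ◅ inj₂ k~m ◅ inj₁ my ◅ ε
  ... | inj₂ (inj₂ (xm , ky)) = inj₁ xm ◅ inj₂ m~k ◅ inj₁ ky ◅ ε

module _ {A B : Rel n} (PA : IsPartition A) (PB : IsPartition B) (k : Fin n) where
  private
    S₁ S₂ : Fin n → Fin n → Set
    S₁ = step (isolate A k) B
    S₂ = step (isolate A k) (isolate B k)

    step-off : ∀ {x y} → x ≢ k → y ≢ k → S₁ x y → S₂ x y
    step-off x≢k y≢k (inj₁ e) = inj₁ e
    step-off x≢k y≢k (inj₂ e) = inj₂ (trans (isolate-off B k x≢k y≢k) e)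

    step-into : ∀ {x} → x ≢ k → S₁ x k → B x k ≡ true
    step-into x≢k (inj₁ e) = ⊥-elim (not-¬ e (isolate-apartʳ A k x≢k))
    step-into x≢k (inj₂ e) = e

    step-out : ∀ {y} → y ≢ k → S₁ k y → B k y ≡ true
    step-out y≢k (inj₁ e) = ⊥-elim (not-¬ e (isolate-apartˡ A k y≢k))
    step-out y≢k (inj₂ e) = e

    -- k is a singleton of isolate A k, so a path visits k only through B-steps,
    -- and two consecutive B-steps around k can be merged by transitivity of B.
    Reaches : Fin n → Fin n → Set
    Reaches x y = (x ≢ k × Star S₂ x y) ⊎
                  (x ≡ k × Σ (Fin n) λ z → z ≢ k × B k z ≡ true × Star S₂ z y)

    reaches : ∀ {x y} → y ≢ k → Star S₁ x y → Reaches x y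
    reaches y≢k ε = inj₁ (y≢k , ε)
    reaches {x} {y} y≢k (_◅_ {j = x₁} s p) = extend (x ≟ k) (reaches y≢k p)
      where
      extend : Dec (x ≡ k) → Reaches x₁ y → Reaches x y
      extend (no x≢k)  (inj₁ (x₁≢k , q)) = inj₁ (x≢k , step-off x≢k x₁≢k s ◅ q)
      extend (yes refl) (inj₁ (x₁≢k , q)) = inj₂ (refl , x₁ , x₁≢k , step-out x₁≢k s , q)
      extend (yes refl) (inj₂ (_ , rest)) = inj₂ (refl , rest)
      extend (no x≢k)  (inj₂ (refl , z , z≢k , kz , q)) =
        inj₁ (x≢k , inj₂ (trans (isolate-off B k x≢k z≢k) (block-trans PB (step-into x≢k s) kz)) ◅ q)

    avoid-k : ∀ {x y} → x ≢ k → y ≢ k → Star S₁ x y → Star (step A (isolate B k)) x y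
    avoid-k x≢k y≢k p with reaches y≢k p
    ... | inj₁ (_ , q) = Star.map widen q
      where
      widen : ∀ {x y} → S₂ x y → step A (isolate B k) x y
      widen {x} {y} (inj₁ e) = inj₁ (isolate-⊆ A k PA x y e)
      widen (inj₂ e) = inj₂ e
    ... | inj₂ (x≡k , _) = ⊥-elim (x≢k x≡k)

  joinSingleBlock-isolate-swap : ∀ {j} → j ≢ k → A k j ≡ true →
    JoinSingleBlock (isolate A k) B → JoinSingleBlock A (isolate B k)
  joinSingleBlock-isolate-swap {j} j≢k kj J a b with a ≟ k | b ≟ k
  ... | yes refl | yes refl = ε
  ... | yes refl | no b≢k   = inj₁ kj ◅ avoid-k j≢k b≢k (J j b)
  ... | no a≢k   | yes refl = avoid-k a≢k j≢k (J a j) ◅◅ inj₁ (block-sym PA kj) ◅ ε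
  ... | no a≢k   | no b≢k   = avoid-k a≢k b≢k (J a b)

pairing-cong : {A B A′ B′ : Rel n} → A ≐ A′ → B ≐ B′ → Pairing A B → Pairing A′ B′
pairing-cong eA eB (count , J) =
  trans (sym (cong₂ _+_ (nBlocks-cong eA) (nBlocks-cong eB))) count , joinSingleBlock-cong eA eB J

pairing-⇔-cong : {τ σ gτ gσ hτ hσ : Rel n} → gτ ≐ hτ → gσ ≐ hσ →
  Pairing hτ σ ⇔ Pairing τ hσ → Pairing gτ σ ⇔ Pairing τ gσ
pairing-⇔-cong eτ eσ h = mk⇔
  (pairing-cong ≐-refl (≐-sym eσ) ∘ Equivalence.to h ∘ pairing-cong eτ ≐-refl)
  (pairing-cong (≐-sym eτ) ≐-refl ∘ Equivalence.from h ∘ pairing-cong ≐-refl eσ)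

pairing-swap : {τ σ gτ gσ : Rel n} → nBlocks gτ + nBlocks σ ≡ nBlocks τ + nBlocks gσ →
  (JoinSingleBlock gτ σ → JoinSingleBlock τ gσ) → (JoinSingleBlock τ gσ → JoinSingleBlock gτ σ) →
  Pairing gτ σ ⇔ Pairing τ gσ
pairing-swap counts to from =
  mk⇔ (λ (c , J) → trans (sym counts) c , to J) (λ (c , J) → trans counts c , from J)

module _ {τ σ : Rel n} (Pτ : IsPartition τ) (Pσ : IsPartition σ) (k : Fin n) where
  pairing-isolate-swap : ∀ {j j′} → j ≢ k → τ k j ≡ true → j′ ≢ k → σ k j′ ≡ true →
    Pairing (isolate τ k) σ ⇔ Pairing τ (isolate σ k)
  pairing-isolate-swap j≢k kj j′≢k kj′ = pairing-swap counts
    (joinSingleBlock-isolate-swap Pτ Pσ k j≢k kj)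
    (joinSingleBlock-comm ∘ joinSingleBlock-isolate-swap Pσ Pτ k j′≢k kj′ ∘ joinSingleBlock-comm)
    where
    counts : nBlocks (isolate τ k) + nBlocks σ ≡ nBlocks τ + nBlocks (isolate σ k)
    counts rewrite nBlocks-isolate Pτ k j≢k kj | nBlocks-isolate Pσ k j′≢k kj′ = sym (+-suc _ _)

  pairing-merge-swap : ∀ {m} → τ k m ≡ false → σ k m ≡ false →
    Pairing (merge τ k m) σ ⇔ Pairing τ (merge σ k m)
  pairing-merge-swap {m} km km′ = pairing-swap counts
    (joinSingleBlock-merge-swap Pσ k m)
    (joinSingleBlock-comm ∘ joinSingleBlock-merge-swap Pτ k m ∘ joinSingleBlock-comm)
    where
    counts : nBlocks (merge τ k m) + nBlocks σ ≡ nBlocks τ + nBlocks (merge σ k m)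
    counts rewrite nBlocks-merge Pτ km | nBlocks-merge Pσ km′ = +-suc _ _

-- Chords between tilde points

pos-bar<tld : ∀ {x a} → x ≤ a → 2 * x < suc (2 * a)
pos-bar<tld x≤a = s≤s (*-monoʳ-≤ 2 x≤a)

pos-tld<bar : ∀ {a z} → a < z → suc (2 * a) < 2 * z
pos-tld<bar {a} {z} a<z = subst (_≤ 2 * z) (*-suc 2 a) (*-monoʳ-≤ 2 a<z)

pos-bar<tld⁻ : ∀ {x a} → 2 * x < suc (2 * a) → x ≤ a
pos-bar<tld⁻ lt = ≮⇒≥ λ a<x → <-asym lt (pos-tld<bar a<x)

pos-tld<bar⁻ : ∀ {a z} → suc (2 * a) < 2 * z → a < z
pos-tld<bar⁻ lt = ≰⇒> λ z≤a → <-asym lt (pos-bar<tld z≤a)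

pos-tld<tld⁻ : ∀ {x y} → suc (2 * x) < suc (2 * y) → x < y
pos-tld<tld⁻ (s≤s lt) = *-cancelˡ-< 2 _ _ lt

-- The chord ã–b̃ cuts off the bar points z with a < z ≤ b (or b < z ≤ a) from the others.
InArc : Fin n → Fin n → Fin n → Set
InArc a b z = (toℕ a < toℕ z × toℕ z ≤ toℕ b) ⊎ (toℕ b < toℕ z × toℕ z ≤ toℕ a)

Uncrossed : Rel n → Fin n → Fin n → Set
Uncrossed {n} R a b = ∀ z w → InArc a b z → ¬ InArc a b w → R z w ≡ true → ⊥

InArc-comm : {a b z : Fin n} → InArc a b z → InArc b a z
InArc-comm (inj₁ z∈) = inj₂ z∈
InArc-comm (inj₂ z∈) = inj₁ z∈

Uncrossed-comm : {R : Rel n} {a b : Fin n} → Uncrossed R a b → Uncrossed R b a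
Uncrossed-comm U z w z∈ w∉ = U z w (InArc-comm z∈) (w∉ ∘ InArc-comm)

module _ {R R′ : Rel n} (P : IsPartition R) (D : IsDual R R′) where
  private
    uncrossed-< : ∀ {a b z w} → R′ a b ≡ true → toℕ a < toℕ z → toℕ z ≤ toℕ b →
      ¬ InArc a b w → R z w ≡ true → ⊥
    uncrossed-< {a} {b} {z} {w} ab a<z z≤b w∉ zw with toℕ w ≤? toℕ a
    ... | yes w≤a with proj₁ (proj₂ D) (bar w) (tld a) (bar z) (tld b)
                         (pos-bar<tld w≤a) (pos-tld<bar a<z) (pos-bar<tld z≤b) (block-sym P zw) ab
    ...   | ()
    uncrossed-< {a} {b} {z} {w} ab a<z z≤b w∉ zw | no w≰a with toℕ w ≤? toℕ b
    ...   | yes w≤b = w∉ (inj₁ (≰⇒> w≰a , w≤b))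
    ...   | no w≰b with proj₁ (proj₂ D) (tld a) (bar z) (tld b) (bar w)
                         (pos-tld<bar a<z) (pos-bar<tld z≤b) (pos-tld<bar (≰⇒> w≰b)) ab zw
    ...     | ()

  dual⇒uncrossed : ∀ {a b} → R′ a b ≡ true → Uncrossed R a b
  dual⇒uncrossed ab z w (inj₁ (a<z , z≤b)) w∉ zw = uncrossed-< ab a<z z≤b w∉ zw
  dual⇒uncrossed ab z w (inj₂ (b<z , z≤a)) w∉ zw =
    uncrossed-< (block-sym (proj₁ D) ab) b<z z≤a (w∉ ∘ InArc-comm) zw

module Chord (a b : Fin n) where
  chord : Rel n
  chord u v = ⌊ u ≟ v ⌋ ∨ (⌊ u ≟ a ⌋ ∧ ⌊ v ≟ b ⌋ ∨ ⌊ u ≟ b ⌋ ∧ ⌊ v ≟ a ⌋)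

  chord-true⁻ : ∀ u v → chord u v ≡ true → u ≡ v ⊎ (u ≡ a × v ≡ b) ⊎ (u ≡ b × v ≡ a)
  chord-true⁻ u v e with ∨-true⁻ {⌊ u ≟ v ⌋} e
  ... | inj₁ u≡v = inj₁ (≟-true⁻ u≡v)
  ... | inj₂ e′ with ∨-true⁻ {⌊ u ≟ a ⌋ ∧ ⌊ v ≟ b ⌋} e′
  ...   | inj₁ e″ = inj₂ (inj₁ (≟-true⁻ (proj₁ (∧-true⁻ e″)) , ≟-true⁻ (proj₂ (∧-true⁻ e″))))
  ...   | inj₂ e″ = inj₂ (inj₂ (≟-true⁻ (proj₁ (∧-true⁻ e″)) , ≟-true⁻ (proj₂ (∧-true⁻ e″))))

  chord-refl : ∀ u → chord u u ≡ true
  chord-refl u = ∨-trueˡ _ (≟-true {a = u} refl)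

  chord-ab : chord a b ≡ true
  chord-ab = ∨-trueʳ ⌊ a ≟ b ⌋ (∨-trueˡ _ (∧-true (≟-true {a = a} refl) (≟-true {a = b} refl)))

  chord-ba : chord b a ≡ true
  chord-ba = ∨-trueʳ ⌊ b ≟ a ⌋
    (∨-trueʳ (⌊ b ≟ a ⌋ ∧ ⌊ a ≟ b ⌋) (∧-true (≟-true {a = b} refl) (≟-true {a = a} refl)))

  chord-partition : IsPartition chord
  chord-partition = chord-refl , sym′ , trans′
    where
    sym′ : ∀ u v → chord u v ≡ true → chord v u ≡ true
    sym′ u v e with chord-true⁻ u v e
    ... | inj₁ refl                = chord-refl u
    ... | inj₂ (inj₁ (refl , refl)) = chord-ba
    ... | inj₂ (inj₂ (refl , refl)) = chord-ab

    trans′ : ∀ u v w → chord u v ≡ true → chord v w ≡ true → chord u w ≡ true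
    trans′ u v w e₁ e₂ with chord-true⁻ u v e₁ | chord-true⁻ v w e₂
    ... | inj₁ refl                 | _                         = e₂
    ... | _                         | inj₁ refl                 = e₁
    ... | inj₂ (inj₁ (refl , refl)) | inj₂ (inj₁ (refl , refl)) = chord-ab
    ... | inj₂ (inj₁ (refl , refl)) | inj₂ (inj₂ (_ , refl))    = chord-refl u
    ... | inj₂ (inj₂ (refl , refl)) | inj₂ (inj₁ (_ , refl))    = chord-refl u
    ... | inj₂ (inj₂ (refl , refl)) | inj₂ (inj₂ (refl , refl)) = chord-ba

  chord-ends : ∀ {u v} → chord u v ≡ true → toℕ u < toℕ v → (u ≡ a × v ≡ b) ⊎ (u ≡ b × v ≡ a)
  chord-ends {u} {v} e u<v with chord-true⁻ u v e
  ... | inj₁ refl = ⊥-elim (<-irrefl refl u<v)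
  ... | inj₂ ends = ends

  module _ {R : Rel n} (N : NCPartition R) (U : Uncrossed R a b) where
    private
      uncrossed : ∀ {q s} → chord q s ≡ true → toℕ q < toℕ s → Uncrossed R q s
      uncrossed e q<s with chord-ends e q<s
      ... | inj₁ (refl , refl) = U
      ... | inj₂ (refl , refl) = Uncrossed-comm U

      tld-apart : ∀ {p q r s} → toℕ p < toℕ q → toℕ q < toℕ r → toℕ r < toℕ s →
        chord p r ≡ true → chord q s ≡ true → ⊥
      tld-apart p<q q<r r<s pr qs with chord-ends pr (<-trans p<q q<r) | chord-ends qs (<-trans q<r r<s)
      ... | inj₁ (refl , refl) | inj₁ (refl , refl) = <-irrefl refl p<q
      ... | inj₁ (refl , refl) | inj₂ (refl , refl) = <-irrefl refl q<r
      ... | inj₂ (refl , refl) | inj₁ (refl , refl) = <-irrefl refl q<r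
      ... | inj₂ (refl , refl) | inj₂ (refl , refl) = <-irrefl refl p<q

    chord-nonCrossing : NonCrossingOn pos (union R chord)
    chord-nonCrossing (bar p) (bar q) (bar r) (bar s) l₁ l₂ l₃ pr qs =
      proj₂ N p q r s (*-cancelˡ-< 2 _ _ l₁) (*-cancelˡ-< 2 _ _ l₂) (*-cancelˡ-< 2 _ _ l₃) pr qs
    chord-nonCrossing (bar p) (tld q) (bar r) (tld s) l₁ l₂ l₃ pr qs =
      ⊥-elim (uncrossed qs (<-≤-trans q<r r≤s) r p (inj₁ (q<r , r≤s)) p∉ (block-sym (proj₁ N) pr))
      where
      p≤q : toℕ p ≤ toℕ q
      p≤q = pos-bar<tld⁻ l₁
      q<r : toℕ q < toℕ r
      q<r = pos-tld<bar⁻ l₂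
      r≤s : toℕ r ≤ toℕ s
      r≤s = pos-bar<tld⁻ l₃
      p∉ : ¬ InArc q s p
      p∉ (inj₁ (q<p , _)) = <⇒≱ q<p p≤q
      p∉ (inj₂ (s<p , _)) = <⇒≱ (<-≤-trans s<p p≤q) (<⇒≤ (<-≤-trans q<r r≤s))
    chord-nonCrossing (tld p) (bar q) (tld r) (bar s) l₁ l₂ l₃ pr qs =
      ⊥-elim (uncrossed pr (<-≤-trans p<q q≤r) q s (inj₁ (p<q , q≤r)) s∉ qs)
      where
      p<q : toℕ p < toℕ q
      p<q = pos-tld<bar⁻ l₁
      q≤r : toℕ q ≤ toℕ r
      q≤r = pos-bar<tld⁻ l₂
      r<s : toℕ r < toℕ s
      r<s = pos-tld<bar⁻ l₃
      s∉ : ¬ InArc p r s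
      s∉ (inj₁ (_ , s≤r)) = <⇒≱ r<s s≤r
      s∉ (inj₂ (_ , s≤p)) = <⇒≱ (<-trans (<-≤-trans p<q q≤r) r<s) s≤p
    chord-nonCrossing (tld p) (tld q) (tld r) (tld s) l₁ l₂ l₃ pr qs =
      ⊥-elim (tld-apart {p} {q} {r} {s} (pos-tld<tld⁻ l₁) (pos-tld<tld⁻ l₂) (pos-tld<tld⁻ l₃) pr qs)
    chord-nonCrossing (bar _) _ (tld _) _ _ _ _ () _
    chord-nonCrossing (tld _) _ (bar _) _ _ _ _ () _
    chord-nonCrossing _ (bar _) _ (tld _) _ _ _ _ ()
    chord-nonCrossing _ (tld _) _ (bar _) _ _ _ _ ()

uncrossed⇒dual : {R R′ : Rel n} → NCPartition R → IsDual R R′ → ∀ {a b} →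
  Uncrossed R a b → R′ a b ≡ true
uncrossed⇒dual N D {a} {b} U = proj₂ (proj₂ D) chord chord-partition (chord-nonCrossing N U) a b chord-ab
  where open Chord a b

-- Separating chords

IsNext : Fin n → Fin n → Set
IsNext {n} v w = toℕ w ≡ suc (toℕ v) ⊎ (toℕ w ≡ 0 × suc (toℕ v) ≡ n)

next : (v : Fin n) → Σ (Fin n) (IsNext v)
next {suc n} v with suc (toℕ v) <? suc n
... | yes v+1<n = F.fromℕ< v+1<n , inj₁ (FinP.toℕ-fromℕ< v+1<n)
... | no  v+1≮n = F.zero , inj₂ (refl , ≤-antisym (FinP.toℕ<n v) (≮⇒≥ v+1≮n))

previous : (w : Fin n) → Σ (Fin n) λ v → IsNext v w
previous {suc n} F.zero    = F.fromℕ n , inj₂ (refl , cong suc (FinP.toℕ-fromℕ n))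
previous         (F.suc w) = F.inject₁ w , inj₁ (cong suc (sym (FinP.toℕ-inject₁ w)))

next-unique : ∀ {v w w′ : Fin n} → IsNext v w → IsNext v w′ → w ≡ w′
next-unique (inj₁ w≡) (inj₁ w′≡) = FinP.toℕ-injective (trans w≡ (sym w′≡))
next-unique (inj₂ (w≡0 , _)) (inj₂ (w′≡0 , _)) = FinP.toℕ-injective (trans w≡0 (sym w′≡0))
next-unique {n} {w = w} (inj₁ w≡) (inj₂ (_ , v+1≡n)) = ⊥-elim (<-irrefl (trans w≡ v+1≡n) (FinP.toℕ<n w))
next-unique {n} {w′ = w′} (inj₂ (_ , v+1≡n)) (inj₁ w′≡) = ⊥-elim (<-irrefl (trans w′≡ v+1≡n) (FinP.toℕ<n w′))

OutsideOf : Fin n → Fin n → Fin n → Set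
OutsideOf x y v = toℕ v < toℕ x ⊎ toℕ y ≤ toℕ v

record Separator (R : Rel n) (x y : Fin n) : Set where
  constructor separator
  field
    u v       : Fin n
    x≤u       : toℕ x ≤ toℕ u
    u<y       : toℕ u < toℕ y
    v-outside : OutsideOf x y v
    uncrossed : Uncrossed R u v

-- s and the successor of t lie in the block of c, so the chord s̃–t̃ runs along a gap of that block.
AlongGap : Rel n → Fin n → Fin n → Fin n → Set
AlongGap {n} R c s t = R c s ≡ true × Σ (Fin n) λ w → IsNext t w × R c w ≡ true

separator-apart : {R S : Rel n} {x y : Fin n} → IsPartition S → (s : Separator R x y) →
  Uncrossed S (Separator.u s) (Separator.v s) → S x y ≡ false
separator-apart {x = x} {y} P (separator u v x≤u u<y (inj₁ v<x) _) U =
  ¬-not λ xy → U x y (inj₂ (v<x , x≤u)) y∉ xy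
  where
  y∉ : ¬ InArc u v y
  y∉ (inj₁ (_ , y≤v)) = <⇒≱ (<-trans v<x (≤-<-trans x≤u u<y)) y≤v
  y∉ (inj₂ (_ , y≤u)) = <⇒≱ u<y y≤u
separator-apart {x = x} {y} P (separator u v x≤u u<y (inj₂ y≤v) _) U =
  ¬-not λ xy → U y x (inj₁ (u<y , y≤v)) x∉ (block-sym P xy)
  where
  x∉ : ¬ InArc u v x
  x∉ (inj₁ (u<x , _)) = <⇒≱ u<x x≤u
  x∉ (inj₂ (v<x , _)) = <⇒≱ v<x (≤-trans x≤u (≤-trans (<⇒≤ u<y) y≤v))

module _ {R : Rel n} (N : NCPartition R) where
  private
    P : IsPartition R
    P = proj₁ N

  leaves-span⇒same-block : ∀ {a c z w} → R a c ≡ true → toℕ a < toℕ z → toℕ z < toℕ c →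
    R z w ≡ true → ¬ (toℕ a < toℕ w × toℕ w < toℕ c) → R a z ≡ true
  leaves-span⇒same-block {a} {c} {z} {w} ac a<z z<c zw w∉ with <-cmp (toℕ w) (toℕ a)
  ... | tri< w<a _ _ =
    block-trans P (block-sym P (proj₂ N w a z c w<a a<z z<c (block-sym P zw) ac)) (block-sym P zw)
  ... | tri≈ _ w≡a _ = subst (λ t → R t z ≡ true) (FinP.toℕ-injective w≡a) (block-sym P zw)
  ... | tri> _ _ a<w with <-cmp (toℕ w) (toℕ c)
  ...   | tri< w<c _ _ = ⊥-elim (w∉ (a<w , w<c))
  ...   | tri≈ _ w≡c _ =
    block-trans P ac (block-sym P (subst (λ t → R z t ≡ true) (FinP.toℕ-injective w≡c) zw))
  ...   | tri> _ _ c<w = proj₂ N a z c w a<z z<c c<w ac zw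

  leaves-span⇒same-block′ : ∀ {b a c z w} → R b a ≡ true → R b c ≡ true → toℕ a ≤ toℕ z → toℕ z ≤ toℕ c →
    R z w ≡ true → ¬ (toℕ a ≤ toℕ w × toℕ w ≤ toℕ c) → R b z ≡ true
  leaves-span⇒same-block′ ba bc a≤z z≤c zw w∉ with m≤n⇒m<n∨m≡n a≤z | m≤n⇒m<n∨m≡n z≤c
  ... | inj₂ a≡z | _        = subst (λ t → R _ t ≡ true) (FinP.toℕ-injective a≡z) ba
  ... | inj₁ _   | inj₂ z≡c = subst (λ t → R _ t ≡ true) (sym (FinP.toℕ-injective z≡c)) bc
  ... | inj₁ a<z | inj₁ z<c = block-trans P ba
    (leaves-span⇒same-block (block-trans P (block-sym P ba) bc) a<z z<c zw
      λ (a<w , w<c) → w∉ (<⇒≤ a<w , <⇒≤ w<c))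

  inner-gap-uncrossed : ∀ {c a u} → R c a ≡ true → toℕ c < toℕ a →
    (∀ z → toℕ c < toℕ z → toℕ z < toℕ a → R c z ≡ false) → toℕ a ≡ suc (toℕ u) → Uncrossed R c u
  inner-gap-uncrossed {c} {a} {u} ca c<a gap a≡u+1 z w (inj₁ (c<z , z≤u)) w∉ zw =
    not-¬ (leaves-span⇒same-block ca c<z z<a zw λ (c<w , w<a) → w∉ (inj₁ (c<w , below-a w<a)))
          (gap z c<z z<a)
    where
    below-a : ∀ {t} → toℕ t < toℕ a → toℕ t ≤ toℕ u
    below-a t<a = ≤-pred (subst (_ <_) a≡u+1 t<a)
    z<a : toℕ z < toℕ a
    z<a = subst (toℕ z <_) (sym a≡u+1) (s≤s z≤u)
  inner-gap-uncrossed ca c<a gap a≡u+1 z w (inj₂ (u<z , z≤c)) w∉ zw =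
    <⇒≱ u<z (≤-trans z≤c (≤-pred (subst (toℕ _ <_) a≡u+1 c<a)))

  outer-gap-uncrossed : ∀ {c a v} → R c a ≡ true → (∀ b → R c b ≡ true → toℕ c ≤ toℕ b × toℕ b ≤ toℕ a) →
    IsNext v c → Uncrossed R a v
  outer-gap-uncrossed {c} {a} {v} ca bounds (inj₁ c≡v+1) z w (inj₁ (a<z , z≤v)) w∉ zw =
    <⇒≱ (<-≤-trans a<z z≤v)
        (≤-trans (≤-trans (n≤1+n _) (≤-reflexive (sym c≡v+1))) (proj₁ (bounds a ca)))
  outer-gap-uncrossed {c} {a} {v} ca bounds (inj₁ c≡v+1) z w (inj₂ (v<z , z≤a)) w∉ zw =
    w∉ (inj₂ (v<w , w≤a))
    where
    c≤z : toℕ c ≤ toℕ z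
    c≤z = subst (_≤ toℕ z) (sym c≡v+1) v<z
    cw : R c w ≡ true
    cw = block-trans P (leaves-span⇒same-block′ (block-refl P c) ca c≤z z≤a zw
                          λ (c≤w , w≤a) → w∉ (inj₂ (subst (_≤ toℕ w) c≡v+1 c≤w , w≤a))) zw
    v<w : toℕ v < toℕ w
    v<w = subst (_≤ toℕ w) c≡v+1 (proj₁ (bounds w cw))
    w≤a : toℕ w ≤ toℕ a
    w≤a = proj₂ (bounds w cw)
  outer-gap-uncrossed {c} {a} {v} ca bounds (inj₂ (c≡0 , v+1≡n)) z w (inj₁ (a<z , z≤v)) w∉ zw =
    <⇒≱ a<z (proj₂ (bounds z (block-trans P cw (block-sym P zw))))
    where
    w≤a : toℕ w ≤ toℕ a
    w≤a = ≮⇒≥ λ a<w → w∉ (inj₁ (a<w , ≤-pred (subst (toℕ w <_) (sym v+1≡n) (FinP.toℕ<n w))))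
    cw : R c w ≡ true
    cw = leaves-span⇒same-block′ (block-refl P c) ca (subst (_≤ toℕ w) (sym c≡0) z≤n) w≤a
           (block-sym P zw)
           λ (_ , z≤a) → <⇒≱ a<z z≤a
  outer-gap-uncrossed {a = a} {v} ca bounds (inj₂ (c≡0 , v+1≡n)) z w (inj₂ (v<z , z≤a)) w∉ zw =
    <⇒≱ (<-≤-trans v<z z≤a) (≤-pred (subst (toℕ a <_) (sym v+1≡n) (FinP.toℕ<n a)))

  private
    Below Above : Fin n → Fin n → Fin n → Set
    Below y a b = R y b ≡ true × toℕ b < toℕ a
    Above y a b = R y b ≡ true × toℕ a < toℕ b

    module _ {x y : Fin n} (x<y : toℕ x < toℕ y) (xy : R x y ≡ false) where
      gap-of-y-around-x : ∀ {a u} → R y a ≡ true → toℕ x < toℕ a → (∀ b → Above y x b → toℕ a ≤ toℕ b) →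
        toℕ a ≡ suc (toℕ u) →
        Σ (Separator R x y) λ S → AlongGap R y (Separator.v S) (Separator.u S)
      gap-of-y-around-x {a} {u} ya x<a a-least a≡u+1 =
        by-cases (FinP.any? λ b → is-true? (R y b) ×-dec (toℕ b <? toℕ a))
        where
        GapSeparator : Set
        GapSeparator = Σ (Separator R x y) λ S → AlongGap R y (Separator.v S) (Separator.u S)

        x≤u : toℕ x ≤ toℕ u
        x≤u = ≤-pred (subst (toℕ x <_) a≡u+1 x<a)

        u<y : toℕ u < toℕ y
        u<y = subst (_≤ toℕ y) a≡u+1 (a-least y (block-refl P y , x<y))

        inner : Greatest (Below y a) → GapSeparator
        inner (c , (yc , c<a) , c-max) =
          separator u c x≤u u<y (inj₁ c<x) (Uncrossed-comm (inner-gap-uncrossed ca c<a gap a≡u+1)) ,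
          yc , a , inj₁ a≡u+1 , ya
          where
          ca : R c a ≡ true
          ca = block-trans P (block-sym P yc) ya
          c<x : toℕ c < toℕ x
          c<x = ≤∧≢⇒< (≮⇒≥ λ x<c → <⇒≱ c<a (a-least c (yc , x<c)))
                      λ c≡x → not-¬ (block-sym P (subst (λ t → R y t ≡ true) (FinP.toℕ-injective c≡x) yc)) xy
          gap : ∀ z → toℕ c < toℕ z → toℕ z < toℕ a → R c z ≡ false
          gap z c<z z<a = ¬-not λ cz → <⇒≱ c<z (c-max z (block-trans P yc cz , z<a))

        outer : ¬ ∃ (Below y a) → Greatest (λ b → R y b ≡ true) → GapSeparator
        outer ∄below (c , yc , c-max) =
          separator u c x≤u u<y (inj₂ (c-max y (block-refl P y)))
            (Uncrossed-comm (outer-gap-uncrossed ac bounds (inj₁ a≡u+1))) ,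
          yc , a , inj₁ a≡u+1 , ya
          where
          ac : R a c ≡ true
          ac = block-trans P (block-sym P ya) yc
          bounds : ∀ b → R a b ≡ true → toℕ a ≤ toℕ b × toℕ b ≤ toℕ c
          bounds b ab = ≮⇒≥ (λ b<a → ∄below (b , block-trans P ya ab , b<a)) , c-max b (block-trans P ya ab)

        by-cases : Dec (∃ (Below y a)) → GapSeparator
        by-cases (yes (b , below)) = inner (greatest (λ b → is-true? (R y b) ×-dec (toℕ b <? toℕ a)) b below)
        by-cases (no ∄below)       = outer ∄below (greatest (is-true? ∘ R y) y (block-refl P y))

      gap-of-x-around-y : ∀ {a} → R x a ≡ true → toℕ x ≤ toℕ a → toℕ a < toℕ y →
        (∀ b → Below x y b → toℕ b ≤ toℕ a) →
        Σ (Separator R x y) λ S → AlongGap R x (Separator.u S) (Separator.v S)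
      gap-of-x-around-y {a} xa x≤a a<y a-max =
        by-cases (FinP.any? λ b → is-true? (R x b) ×-dec (toℕ a <? toℕ b))
        where
        GapSeparator : Set
        GapSeparator = Σ (Separator R x y) λ S → AlongGap R x (Separator.u S) (Separator.v S)

        inner : Least (Above x a) → GapSeparator
        inner (c , (xc , a<c) , c-least) with previous c
        ... | _ , inj₂ (c≡0 , _) = ⊥-elim (n≮0 (subst (toℕ a <_) c≡0 a<c))
        ... | v , inj₁ c≡v+1 =
          separator a v x≤a a<y (inj₂ y≤v) (inner-gap-uncrossed ac a<c gap c≡v+1) ,
          xa , c , inj₁ c≡v+1 , xc
          where
          ac : R a c ≡ true
          ac = block-trans P (block-sym P xa) xc
          y<c : toℕ y < toℕ c
          y<c = ≤∧≢⇒< (≮⇒≥ λ c<y → <⇒≱ a<c (a-max c (xc , c<y)))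
                      λ y≡c → not-¬ (subst (λ t → R x t ≡ true) (sym (FinP.toℕ-injective y≡c)) xc) xy
          y≤v : toℕ y ≤ toℕ v
          y≤v = ≤-pred (subst (toℕ y <_) c≡v+1 y<c)
          gap : ∀ z → toℕ a < toℕ z → toℕ z < toℕ c → R a z ≡ false
          gap z a<z z<c = ¬-not λ az → <⇒≱ z<c (c-least z (block-trans P xa az , a<z))

        outer : ¬ ∃ (Above x a) → Least (λ b → R x b ≡ true) → GapSeparator
        outer ∄above (c , xc , c-min) with previous c
        ... | v , v→c =
          separator a v x≤a a<y (outside v→c) (outer-gap-uncrossed ca bounds v→c) , xa , c , v→c , xc
          where
          ca : R c a ≡ true
          ca = block-trans P (block-sym P xc) xa
          bounds : ∀ b → R c b ≡ true → toℕ c ≤ toℕ b × toℕ b ≤ toℕ a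
          bounds b cb = c-min b (block-trans P xc cb) , ≮⇒≥ λ a<b → ∄above (b , block-trans P xc cb , a<b)
          outside : IsNext v c → OutsideOf x y v
          outside (inj₁ c≡v+1)       = inj₁ (subst (_≤ toℕ x) c≡v+1 (c-min x (block-refl P x)))
          outside (inj₂ (_ , v+1≡n)) = inj₂ (≤-pred (subst (toℕ y <_) (sym v+1≡n) (FinP.toℕ<n y)))

        by-cases : Dec (∃ (Above x a)) → GapSeparator
        by-cases (yes (b , above)) = inner (least (λ b → is-true? (R x b) ×-dec (toℕ a <? toℕ b)) b above)
        by-cases (no ∄above)       = outer ∄above (least (is-true? ∘ R x) x (block-refl P x))

  separator-along-block-of-y : ∀ {x y} → toℕ x < toℕ y → R x y ≡ false →
    Σ (Separator R x y) λ S → AlongGap R y (Separator.v S) (Separator.u S)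
  separator-along-block-of-y {x} {y} x<y xy
    with least (λ b → is-true? (R y b) ×-dec (toℕ x <? toℕ b)) y (block-refl P y , x<y)
  ... | a , (ya , x<a) , a-least with previous a
  ...   | _ , inj₂ (a≡0 , _) = ⊥-elim (n≮0 (subst (toℕ x <_) a≡0 x<a))
  ...   | _ , inj₁ a≡u+1 = gap-of-y-around-x x<y xy ya x<a a-least a≡u+1

  separator-along-block-of-x : ∀ {x y} → toℕ x < toℕ y → R x y ≡ false →
    Σ (Separator R x y) λ S → AlongGap R x (Separator.u S) (Separator.v S)
  separator-along-block-of-x {x} {y} x<y xy
    with greatest (λ b → is-true? (R x b) ×-dec (toℕ b <? toℕ y)) x (block-refl P x , x<y)
  ... | a , (xa , a<y) , a-max = gap-of-x-around-y x<y xy xa (a-max x (block-refl P x , x<y)) a<y a-max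

  -- If k and its successor m were in different blocks, the gap of the block of m containing k
  -- would be bounded by a chord ending at k̃.
  no-chord⇒joins-next : ∀ {k m} → (∀ v → Uncrossed R k v → v ≡ k) → IsNext k m → R k m ≡ true
  no-chord⇒joins-next {k} {m} only-k k→m = ¬-not λ km → stuck km k→m
    where
    stuck : R k m ≡ false → IsNext k m → ⊥
    stuck km (inj₁ m≡k+1) with separator-along-block-of-y (≤-reflexive (sym m≡k+1)) km
    ... | separator u v k≤u u<m v∉ U , _
      with FinP.toℕ-injective (≤-antisym (≤-pred (subst (toℕ u <_) m≡k+1 u<m)) k≤u)
    ...   | refl with only-k v U | v∉
    ...     | refl | inj₁ k<k = <-irrefl refl k<k
    ...     | refl | inj₂ m≤k = <⇒≱ (≤-reflexive (sym m≡k+1)) m≤k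
    stuck km (inj₂ (m≡0 , k+1≡n)) with <-cmp (toℕ m) (toℕ k)
    ... | tri≈ _ m≡k _ =
      not-¬ (subst (λ t → R k t ≡ true) (FinP.toℕ-injective (sym m≡k)) (block-refl P k)) km
    ... | tri> _ _ k<m = n≮0 (subst (toℕ k <_) m≡0 k<m)
    ... | tri< m<k _ _ with separator-along-block-of-y m<k (block-sym-false P km)
    ...   | separator u v _ u<k v∉ U , _ =
      <-irrefl (cong toℕ (only-k u (Uncrossed-comm (subst (Uncrossed R u) (v≡k v∉) U)))) u<k
      where
      v≡k : OutsideOf m k v → v ≡ k
      v≡k (inj₁ v<m) = ⊥-elim (n≮0 (subst (toℕ v <_) m≡0 v<m))
      v≡k (inj₂ k≤v) =
        FinP.toℕ-injective (≤-antisym (≤-pred (subst (toℕ v <_) (sym k+1≡n) (FinP.toℕ<n v))) k≤v)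

chord-separates-next : {R : Rel n} → IsPartition R → ∀ {k j m} → j ≢ k → Uncrossed R k j → IsNext k m →
  R k m ≡ false
chord-separates-next {R = R} P {k} {j} {m} j≢k U k→m = ¬-not (across (<-cmp (toℕ k) (toℕ j)) k→m)
  where
  across : Tri (toℕ k < toℕ j) (toℕ k ≡ toℕ j) (toℕ j < toℕ k) → IsNext k m → R k m ≡ true → ⊥
  across (tri≈ _ k≡j _) _ _ = j≢k (sym (FinP.toℕ-injective k≡j))
  across (tri< k<j _ _) (inj₂ (_ , k+1≡n)) _ = <⇒≱ (FinP.toℕ<n j) (subst (_≤ toℕ j) k+1≡n k<j)
  across (tri< k<j _ _) (inj₁ m≡k+1) km =
    U m k (inj₁ (≤-reflexive (sym m≡k+1) , subst (_≤ toℕ j) (sym m≡k+1) k<j)) k∉ (block-sym P km)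
    where
    k∉ : ¬ InArc k j k
    k∉ (inj₁ (k<k , _)) = <-irrefl refl k<k
    k∉ (inj₂ (j<k , _)) = <-asym j<k k<j
  across (tri> _ _ j<k) _ km = U k m (inj₂ (j<k , ≤-refl)) (m∉ k→m) km
    where
    m∉ : IsNext k m → ¬ InArc k j m
    m∉ (inj₁ m≡k+1) (inj₁ (_ , m≤j)) = <⇒≱ (<-trans j<k (≤-reflexive (sym m≡k+1))) m≤j
    m∉ (inj₁ m≡k+1) (inj₂ (_ , m≤k)) = <⇒≱ (≤-reflexive (sym m≡k+1)) m≤k
    m∉ (inj₂ (m≡0 , _)) (inj₁ (k<m , _)) = n≮0 (subst (toℕ k <_) m≡0 k<m)
    m∉ (inj₂ (m≡0 , _)) (inj₂ (j<m , _)) = n≮0 (subst (toℕ j <_) m≡0 j<m)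

module _ {A B : Rel n} (NA : NCPartition A) (PB : IsPartition B)
         (transfer : ∀ {u v} → Uncrossed A u v → Uncrossed B u v) where
  private
    apart-< : ∀ {x y} → toℕ x < toℕ y → A x y ≡ false → B x y ≡ false
    apart-< x<y axy with separator-along-block-of-y NA x<y axy
    ... | s , _ = separator-apart PB s (transfer (Separator.uncrossed s))

  -- Points in different blocks of A are separated by an A-uncrossed chord, which B respects too.
  ⊆-of-uncrossed : B ⊆ᴮ A
  ⊆-of-uncrossed x y bxy = ¬-not λ axy → not-¬ bxy (apart axy)
    where
    apart : A x y ≡ false → B x y ≡ false
    apart axy with <-cmp (toℕ x) (toℕ y)
    ... | tri< x<y _ _ = apart-< x<y axy
    ... | tri≈ _ x≡y _ =
      ⊥-elim (not-¬ (subst (λ t → A x t ≡ true) (FinP.toℕ-injective x≡y) (block-refl (proj₁ NA) x)) axy)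
    ... | tri> _ _ y<x = block-sym-false PB (apart-< y<x (block-sym-false (proj₁ NA) axy))

-- Isolating a tilde point

module TildeIsolation {τ ρ τ̃ ρ̃ : Rel n} (Nτ : NCPartition τ) (Nρ : NCPartition ρ)
                      (Dτ : IsDual τ τ̃) (Dρ : IsDual ρ ρ̃) (k : Fin n) (ρ̃≐ : ρ̃ ≐ isolate τ̃ k) where
  private
    Pτ : IsPartition τ
    Pτ = proj₁ Nτ
    Pρ : IsPartition ρ
    Pρ = proj₁ Nρ

    uncrossed-ρ⇒τ : ∀ {u v} → Uncrossed ρ u v → Uncrossed τ u v
    uncrossed-ρ⇒τ {u} {v} U =
      dual⇒uncrossed Pτ Dτ
        (isolate-⊆ τ̃ k (proj₁ Dτ) u v (trans (sym (ρ̃≐ u v)) (uncrossed⇒dual Nρ Dρ U)))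

    isolated⇒uncrossed-ρ : ∀ {u v} → isolate τ̃ k u v ≡ true → Uncrossed ρ u v
    isolated⇒uncrossed-ρ {u} {v} e = dual⇒uncrossed Pρ Dρ (trans (ρ̃≐ u v) e)

    uncrossed-τ⇒ρ : ∀ {u v} → u ≢ k → v ≢ k → Uncrossed τ u v → Uncrossed ρ u v
    uncrossed-τ⇒ρ u≢k v≢k U =
      isolated⇒uncrossed-ρ (trans (isolate-off τ̃ k u≢k v≢k) (uncrossed⇒dual Nτ Dτ U))

  τ⊆ρ : τ ⊆ᴮ ρ
  τ⊆ρ = ⊆-of-uncrossed Nρ Pτ uncrossed-ρ⇒τ

  ≐-of-singleton : (∀ j → Uncrossed τ k j → j ≡ k) → ρ ≐ τ
  ≐-of-singleton only-k x y = bool-ext (⊆-of-uncrossed Nτ Pρ transfer x y) (τ⊆ρ x y)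
    where
    transfer : ∀ {u v} → Uncrossed τ u v → Uncrossed ρ u v
    transfer {u} {v} U with u ≟ k | v ≟ k
    ... | yes refl | yes refl = isolated⇒uncrossed-ρ (isolate-self τ̃ k)
    ... | no u≢k   | no v≢k   = uncrossed-τ⇒ρ u≢k v≢k U
    ... | yes refl | no v≢k   = ⊥-elim (v≢k (only-k v U))
    ... | no u≢k   | yes refl = ⊥-elim (u≢k (only-k u (Uncrossed-comm U)))

  m : Fin n
  m = proj₁ (next k)

  ρ-joins-next : ρ k m ≡ true
  ρ-joins-next = no-chord⇒joins-next Nρ only-k (proj₂ (next k))
    where
    only-k : ∀ v → Uncrossed ρ k v → v ≡ k
    only-k v U with v ≟ k
    ... | yes v≡k = v≡k
    ... | no v≢k  =
      ⊥-elim (not-¬ (trans (sym (ρ̃≐ k v)) (uncrossed⇒dual Nρ Dρ U)) (isolate-apartˡ τ̃ k v≢k))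

  merge⊆ρ : merge τ k m ⊆ᴮ ρ
  merge⊆ρ x y e with merge-true⁻ τ k m e
  ... | inj₁ xy               = τ⊆ρ x y xy
  ... | inj₂ (inj₁ (xk , my)) = block-trans Pρ (block-trans Pρ (τ⊆ρ x k xk) ρ-joins-next) (τ⊆ρ m y my)
  ... | inj₂ (inj₂ (xm , ky)) =
    block-trans Pρ (block-trans Pρ (τ⊆ρ x m xm) (block-sym Pρ ρ-joins-next)) (τ⊆ρ k y ky)

  private
    -- A τ-uncrossed chord separating a ρ-pair must end at k̃, as all others survive in ρ̃.
    touches-k : ∀ {x y} (s : Separator τ x y) → ρ x y ≡ true → Separator.u s ≡ k ⊎ Separator.v s ≡ k
    touches-k s ρxy with Separator.u s ≟ k | Separator.v s ≟ k
    ... | yes u≡k | _       = inj₁ u≡k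
    ... | no _    | yes v≡k = inj₂ v≡k
    ... | no u≢k  | no v≢k  =
      ⊥-elim (not-¬ ρxy (separator-apart Pρ s (uncrossed-τ⇒ρ u≢k v≢k (Separator.uncrossed s))))

    next-k : ∀ {w} → IsNext k w → w ≡ m
    next-k k→w = next-unique k→w (proj₂ (next k))

    new-pair : ∀ {x y} → toℕ x < toℕ y → τ x y ≡ false → ρ x y ≡ true → merge τ k m x y ≡ true
    new-pair x<y τxy ρxy with separator-along-block-of-x Nτ x<y τxy | separator-along-block-of-y Nτ x<y τxy
    ... | s₁ , xu₁ , w₁ , v₁→w₁ , xw₁ | s₂ , yv₂ , w₂ , u₂→w₂ , yw₂
      with touches-k s₁ ρxy | touches-k s₂ ρxy
    ... | inj₁ refl | inj₂ refl = ⊥-elim (not-¬ (block-trans Pτ xu₁ (block-sym Pτ yv₂)) τxy)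
    ... | inj₁ refl | inj₁ refl with refl ← next-k u₂→w₂ = merge-joinˡ τ k m xu₁ (block-sym Pτ yw₂)
    ... | inj₂ refl | inj₂ refl with refl ← next-k v₁→w₁ = merge-joinʳ τ k m xw₁ (block-sym Pτ yv₂)
    ... | inj₂ refl | inj₁ refl with refl ← next-k v₁→w₁ | refl ← next-k u₂→w₂ =
      ⊥-elim (not-¬ (block-trans Pτ xw₁ (block-sym Pτ yw₂)) τxy)

  ρ⊆merge : ρ ⊆ᴮ merge τ k m
  ρ⊆merge x y ρxy with is-true? (τ x y)
  ... | yes τxy = merge-⊇ τ k m x y τxy
  ... | no τxy≢true with ¬-not τxy≢true | <-cmp (toℕ x) (toℕ y)
  ...   | τxy | tri< x<y _ _ = new-pair x<y τxy ρxy
  ...   | _   | tri≈ _ x≡y _ =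
    subst (λ t → merge τ k m x t ≡ true) (FinP.toℕ-injective x≡y) (merge-⊇ τ k m x x (block-refl Pτ x))
  ...   | τxy | tri> _ _ y<x = merge-sym Pτ (new-pair y<x (block-sym-false Pτ τxy) (block-sym Pρ ρxy))

  ≐-merge-next : ρ ≐ merge τ k m
  ≐-merge-next x y = bool-ext (ρ⊆merge x y) (merge⊆ρ x y)

bar-injective : {a b : Fin n} → bar a ≡ bar b → a ≡ b
bar-injective refl = refl

tld-injective : {a b : Fin n} → tld a ≡ tld b → a ≡ b
tld-injective refl = refl

block-mate? : (R : Rel n) (k : Fin n) → Dec (∃ λ j → j ≢ k × R k j ≡ true)
block-mate? R k = FinP.any? λ j → ¬? (j ≟ k) ×-dec is-true? (R k j)

module _ {R R′ : Rel n} {k : Fin n} where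
  bar-block-mate : ¬ IsSingleton (union R R′) (bar k) → ∃ λ j → j ≢ k × R k j ≡ true
  bar-block-mate ns with block-mate? R k
  ... | yes mate = mate
  ... | no ∄mate = ⊥-elim (ns singleton)
    where
    singleton : IsSingleton (union R R′) (bar k)
    singleton (bar j) kj with j ≟ k
    ... | yes j≡k = cong bar j≡k
    ... | no j≢k  = ⊥-elim (∄mate (j , j≢k , kj))

  tld-block-mate : ¬ IsSingleton (union R R′) (tld k) → ∃ λ j → j ≢ k × R′ k j ≡ true
  tld-block-mate ns with block-mate? R′ k
  ... | yes mate = mate
  ... | no ∄mate = ⊥-elim (ns singleton)
    where
    singleton : IsSingleton (union R R′) (tld k)
    singleton (tld j) kj with j ≟ k
    ... | yes j≡k = cong tld j≡k
    ... | no j≢k  = ⊥-elim (∄mate (j , j≢k , kj))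

isolation-of-singleton : {τ τ′ g : Rel n} (i : Pt n) → NCPartition τ → IsDual τ τ′ →
  IsSingleton (union τ τ′) i → IsIsolation i τ g → g ≐ τ
isolation-of-singleton {τ = τ} (bar k) N D singleton (_ , g≐) =
  ≐-trans g≐ (isolate-singleton τ k (proj₁ N) λ j kj → bar-injective (singleton (bar j) kj))
isolation-of-singleton (tld k) N D singleton (Ng , _ , _ , Dτ̃ , Dg , g̃≐) =
  TildeIsolation.≐-of-singleton N Ng Dτ̃ Dg k g̃≐ λ j U →
    tld-injective (singleton (tld j) (uncrossed⇒dual N D U))

tld-isolation-merges : {τ τ′ g : Rel n} {k : Fin n} → NCPartition τ → IsDual τ τ′ →
  ¬ IsSingleton (union τ τ′) (tld k) → IsIsolation (tld k) τ g →
  τ k (proj₁ (next k)) ≡ false × g ≐ merge τ k (proj₁ (next k))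
tld-isolation-merges {k = k} N D ns (Ng , _ , _ , Dτ̃ , Dg , g̃≐) with tld-block-mate ns
... | j , j≢k , kj =
  chord-separates-next (proj₁ N) j≢k (dual⇒uncrossed (proj₁ N) D kj) (proj₂ (next k)) ,
  TildeIsolation.≐-merge-next N Ng Dτ̃ Dg k g̃≐

proposition4p30 : (n : ℕ) (τ σ τ' σ' : Rel n) →
    NCPartition τ → NCPartition σ → IsDual τ τ' → IsDual σ σ' →
    (i : Pt n) →
    ((¬ IsSingleton (union τ τ') i × ¬ IsSingleton (union σ σ') i) ⊎
     (IsSingleton (union τ τ') i × IsSingleton (union σ σ') i)) →
    (gτ gσ : Rel n) → IsIsolation i τ gτ → IsIsolation i σ gσ →
    Pairing gτ σ ⇔ Pairing τ gσ
proposition4p30 n τ σ τ' σ' Nτ Nσ Dτ Dσ i (inj₂ (sτ , sσ)) gτ gσ Iτ Iσ =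
  pairing-⇔-cong (isolation-of-singleton i Nτ Dτ sτ Iτ) (isolation-of-singleton i Nσ Dσ sσ Iσ) (mk⇔ id id)
proposition4p30 n τ σ τ' σ' Nτ Nσ Dτ Dσ (bar k) (inj₁ (nsτ , nsσ)) gτ gσ (_ , gτ≐) (_ , gσ≐)
  with bar-block-mate nsτ | bar-block-mate nsσ
... | j , j≢k , kj | j′ , j′≢k , kj′ =
  pairing-⇔-cong gτ≐ gσ≐ (pairing-isolate-swap (proj₁ Nτ) (proj₁ Nσ) k j≢k kj j′≢k kj′)
proposition4p30 n τ σ τ' σ' Nτ Nσ Dτ Dσ (tld k) (inj₁ (nsτ , nsσ)) gτ gσ Iτ Iσ
  with tld-isolation-merges Nτ Dτ nsτ Iτ | tld-isolation-merges Nσ Dσ nsσ Iσ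
... | τ-apart , gτ≐ | σ-apart , gσ≐ =
  pairing-⇔-cong gτ≐ gσ≐ (pairing-merge-swap (proj₁ Nτ) (proj₁ Nσ) k τ-apart σ-apart)
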